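{- For every positive integer $m\equiv 3\pmod 6$ there exists a $3$-SCHGDD of type $(6,m^3)$.
   Context: Let $I_n=\{0,1,\ldots,n-1\}$, $Z_v$ the integers modulo $v$, and $S=\{0,t,\ldots,(m-1)t\}\le Z_{mt}$. A $3$-SCHGDD of type $(n,m^t)$ is a family $\mathcal{B}^*$ of $3$-element subsets of $I_n\times Z_{mt}$ such that the multiset $\Delta_{ij}(\mathcal{B}^*)=\bigcup_{B\in\mathcal{B}^*}\{x-y \pmod{mt}:(i,x),(j,y)\in B,(i,x)\neq(j,y)\}$ equals $Z_{mt}\setminus S$ (each element exactly once) for all $i\ne j$ in $I_n$, and is empty for $i=j$. -}

module Defs where

open import Data.Nat using (ℕ; _+_; _*_; _∸_; _<_; _≤ᵇ_)
open import Data.Nat.Properties using (_≟_)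
open import Data.Bool using (if_then_else_)
open import Data.Fin using (Fin; toℕ)
import Data.Fin
import Relation.Nullary
open import Data.List using (List; []; _∷_; length; filter; concatMap)
open import Data.Product using (_×_; _,_; proj₁; proj₂; Σ; ∃)
open import Relation.Binary.PropositionalEquality using (_≡_; _≢_)
open import Relation.Nullary using (¬_)

-- A point of I_n × Z_v (rows I_n = Fin n, Z_v represented by Fin v).
Point : ℕ → ℕ → Set
Point n v = Fin n × Fin v

record Block (n v : ℕ) : Set where
  constructor block
  field
    p₁ p₂ p₃ : Point n v
    d₁₂ : p₁ ≢ p₂
    d₁₃ : p₁ ≢ p₃
    d₂₃ : p₂ ≢ p₃
open Block public

-- x - y (mod v), as a natural number in {0,…,v-1}, for x y ∈ Z_v.
zdiff : (v : ℕ) → Fin v → Fin v → ℕ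
zdiff v x y = if toℕ y ≤ᵇ toℕ x then toℕ x ∸ toℕ y else (v + toℕ x) ∸ toℕ y

orderedPairs : ∀ {n v} → Block n v → List (Point n v × Point n v)
orderedPairs B =
  (p₁ B , p₂ B) ∷ (p₂ B , p₁ B) ∷ (p₁ B , p₃ B) ∷ (p₃ B , p₁ B) ∷
  (p₂ B , p₃ B) ∷ (p₃ B , p₂ B) ∷ []

diffsIn : ∀ {n v} → Fin n → Fin n → Block n v → List ℕ
diffsIn {n} {v} i j B = go (orderedPairs B)
  where
  go : List (Point n v × Point n v) → List ℕ
  go [] = []
  go (((i' , x) , (j' , y)) ∷ ps) with Data.Fin._≟_ i' i | Data.Fin._≟_ j' j
  ... | Relation.Nullary.yes _ | Relation.Nullary.yes _ = zdiff v x y ∷ go ps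
  ... | _ | _ = go ps

Δ : ∀ {n v} → Fin n → Fin n → List (Block n v) → List ℕ
Δ i j Bs = concatMap (diffsIn i j) Bs

mult : ℕ → List ℕ → ℕ
mult d xs = length (filter (_≟ d) xs)

InS : (m t : ℕ) → ℕ → Set
InS m t d = Σ ℕ λ k → k < m × d ≡ k * t

Is3SCHGDD : (n m t : ℕ) → List (Block n (m * t)) → Set
Is3SCHGDD n m t Bs =
  (∀ (i : Fin n) → Δ i i Bs ≡ []) ×
  (∀ (i j : Fin n) → i ≢ j → ∀ (d : ℕ) → d < m * t →
     (InS m t d → mult d (Δ i j Bs) ≡ 0) ×
     (¬ InS m t d → mult d (Δ i j Bs) ≡ 1))

Exists3SCHGDD : (n m t : ℕ) → Set
Exists3SCHGDD n m t = Σ (List (Block n (m * t))) (Is3SCHGDD n m t)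

-- Write m = 3q with q odd, so that the differences live in ℤ_{9q} and the multiples of 3 are the
-- differences ≡ 0, 3, 6 (mod 9).  A base block with rows r₀, r₁, r₂ and residues c₁, c₃ yields the
-- q blocks {(r₀, 0), (r₁, 9k + c₁), (r₂, 18k + c₁ + c₃)}, k < q.  Their differences between rows r₁
-- and r₀ are 9k + c₁, between r₂ and r₁ are 9k + c₃, and between r₂ and r₀ are 9(2k + h) + c₂ where
-- c₁ + c₃ = 9h + c₂.  As 2 is invertible modulo the odd number q, each of these sequences runs
-- through one residue class modulo 9 exactly once, and the reversed row pairs get the negated class.
-- So every base block contributes one class modulo 9 to each ordered pair of its rows, and a table of
-- 30 base blocks gives every ordered pair of distinct rows each of the classes 1, 2, 4, 5, 7, 8
-- exactly once.

module Submission where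

open import Defs
open import Data.Bool using (true; false; if_then_else_; T)
open import Data.Empty using (⊥; ⊥-elim)
open import Data.Fin as Fin using (Fin; toℕ; fromℕ<; #_)
open import Data.Fin.Patterns using (0F; 1F; 2F)
import Data.Fin.Properties as Finₚ
open import Data.List using (List; []; _∷_; _++_; length; filter; concatMap; applyDownFrom; map; allFin; cartesianProduct)
open import Data.List.Properties using (concatMap-++; length-++; filter-++; filter-accept; filter-reject; ∷-injective)
open import Data.List.Membership.Propositional using (_∈_)
open import Data.List.Membership.Propositional.Properties using (∈-allFin; ∈-cartesianProduct⁺)
open import Data.List.Relation.Unary.Any using (here; there)
open import Data.Maybe using (Maybe; just; nothing; maybe; _>>=_)
open import Data.Nat
open import Data.Nat.Properties
open import Data.Nat.DivMod
open import Data.Nat.Divisibility using (_∣_; divides; >⇒∤)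
open import Data.Nat.Coprimality using (Coprime; coprime-divisor; 1-coprimeTo; coprime-+)
open import Data.Nat.Tactic.RingSolver using (solve-∀)
open import Data.Product using (Σ; ∃; _×_; _,_; proj₁; proj₂)
open import Data.Sum using (_⊎_; [_,_]′)
open import Data.Unit using (tt)
open import Function using (_∘_)
open import Relation.Binary.PropositionalEquality using (_≡_; _≢_; refl; sym; trans; cong; cong₂; subst; module ≡-Reasoning)
open import Relation.Binary.Definitions using (tri<; tri≈; tri>)
open import Relation.Nullary using (¬_; yes; no; does; contradiction)
open import Relation.Nullary.Decidable using (True; False; toWitness; toWitnessFalse; from-yes; _⊎-dec_)

open ≡-Reasoning

mult-++ : ∀ d xs ys → mult d (xs ++ ys) ≡ mult d xs + mult d ys
mult-++ d xs ys = trans (cong length (filter-++ (_≟ d) xs ys)) (length-++ (filter (_≟ d) xs))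

mult-applyDownFrom-absent : ∀ {d} (w : ℕ → ℕ) n → (∀ {k} → k < n → w k ≢ d) →
                            mult d (applyDownFrom w n) ≡ 0
mult-applyDownFrom-absent w zero    absent = refl
mult-applyDownFrom-absent {d} w (suc n) absent =
  trans (cong length (filter-reject (_≟ d) (absent ≤-refl)))
        (mult-applyDownFrom-absent w n (absent ∘ m<n⇒m<1+n))

mult-applyDownFrom-unique : ∀ {d} (w : ℕ → ℕ) n {k₀} → k₀ < n → w k₀ ≡ d →
                            (∀ {k} → k < n → w k ≡ d → k ≡ k₀) →
                            mult d (applyDownFrom w n) ≡ 1
mult-applyDownFrom-unique {d} w (suc n) {k₀} k₀<1+n wk₀≡d unique with n ≟ k₀
... | yes refl =
  trans (cong length (filter-accept (_≟ d) wk₀≡d))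
        (cong suc (mult-applyDownFrom-absent w n λ k<n wk≡d → <-irrefl (unique (m<n⇒m<1+n k<n) wk≡d) k<n))
... | no n≢k₀ =
  trans (cong length (filter-reject (_≟ d) (n≢k₀ ∘ unique ≤-refl)))
        (mult-applyDownFrom-unique w n (≤∧≢⇒< (s≤s⁻¹ k₀<1+n) (n≢k₀ ∘ sym)) wk₀≡d (unique ∘ m<n⇒m<1+n))

map-≡⇒∈⇒≡ : ∀ {A B : Set} (f g : A → B) {xs x} → map f xs ≡ map g xs → x ∈ xs → f x ≡ g x
map-≡⇒∈⇒≡ f g {_ ∷ _} eq (here refl) = proj₁ (∷-injective eq)
map-≡⇒∈⇒≡ f g {_ ∷ _} eq (there x∈) = map-≡⇒∈⇒≡ f g (proj₂ (∷-injective eq)) x∈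

injective⇒surjective : ∀ {n} (f : Fin n → Fin n) → (∀ {x y} → f x ≡ f y → x ≡ y) →
                       ∀ y → ∃ λ x → f x ≡ y
injective⇒surjective {suc n} f f-injective y with Finₚ.any? (λ x → f x Fin.≟ y)
... | yes hit = hit
... | no miss = ⊥-elim collision
  where
  y≢f : ∀ x → y ≢ f x
  y≢f x y≡fx = miss (x , sym y≡fx)
  collision : ⊥
  collision with x , x' , x<x' , eq ← Finₚ.pigeonhole (n<1+n n) (λ x → Fin.punchOut (y≢f x))
    = Finₚ.<⇒≢ x<x' (f-injective (Finₚ.punchOut-injective (y≢f x) (y≢f x') eq))

injectiveOn⇒surjectiveOn : ∀ {n} (f : ℕ → ℕ) → (∀ {k} → k < n → f k < n) →
                           (∀ {k k'} → k < n → k' < n → f k ≡ f k' → k ≡ k') →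
                           ∀ {e} → e < n → ∃ λ k → k < n × f k ≡ e
injectiveOn⇒surjectiveOn {n} f f< f-injective {e} e<n =
  toℕ x , Finₚ.toℕ<n x , trans (sym (toℕ-f̂ x)) (trans (cong toℕ f̂x≡e) (Finₚ.toℕ-fromℕ< e<n))
  where
  f̂ : Fin n → Fin n
  f̂ x = fromℕ< (f< (Finₚ.toℕ<n x))
  toℕ-f̂ : ∀ x → toℕ (f̂ x) ≡ f (toℕ x)
  toℕ-f̂ x = Finₚ.toℕ-fromℕ< (f< (Finₚ.toℕ<n x))
  f̂-injective : ∀ {x y} → f̂ x ≡ f̂ y → x ≡ y
  f̂-injective {x} {y} eq = Finₚ.toℕ-injective
    (f-injective (Finₚ.toℕ<n x) (Finₚ.toℕ<n y) (trans (sym (toℕ-f̂ x)) (trans (cong toℕ eq) (toℕ-f̂ y))))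
  x = proj₁ (injective⇒surjective f̂ f̂-injective (fromℕ< e<n))
  f̂x≡e = proj₂ (injective⇒surjective f̂ f̂-injective (fromℕ< e<n))

%≡%⇒∣∸ : ∀ {x y} q .{{_ : NonZero q}} → x % q ≡ y % q → q ∣ x ∸ y
%≡%⇒∣∸ {x} {y} q x%q≡y%q = divides (x / q ∸ y / q) (begin
  x ∸ y                                     ≡⟨ cong₂ _∸_ (m≡m%n+[m/n]*n x q) (m≡m%n+[m/n]*n y q) ⟩
  (x % q + x / q * q) ∸ (y % q + y / q * q) ≡⟨ cong (λ r → (x % q + x / q * q) ∸ (r + y / q * q)) (sym x%q≡y%q) ⟩
  (x % q + x / q * q) ∸ (x % q + y / q * q) ≡⟨ [m+n]∸[m+o]≡n∸o (x % q) _ _ ⟩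
  x / q * q ∸ y / q * q                     ≡⟨ *-distribʳ-∸ q (x / q) (y / q) ⟨
  (x / q ∸ y / q) * q                       ∎)

∣∧<⇒≡0 : ∀ {q x} → q ∣ x → x < q → x ≡ 0
∣∧<⇒≡0 {x = zero}  _   _   = refl
∣∧<⇒≡0 {x = suc x} q∣x x<q = contradiction q∣x (>⇒∤ x<q)

affine%-injective : ∀ {q a h k k'} .{{_ : NonZero q}} → Coprime q a → k < q → k' < q →
                    (h + a * k) % q ≡ (h + a * k') % q → k ≡ k'
affine%-injective {q} {a} {h} {k} {k'} q⊥a k<q k'<q eq =
  [ (λ k'≤k → ≤-antisym (below k<q k'≤k eq) k'≤k)
  , (λ k≤k' → ≤-antisym k≤k' (below k'<q k≤k' (sym eq)))
  ]′ (≤-total k' k)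
  where
  below : ∀ {k k'} → k < q → k' ≤ k → (h + a * k) % q ≡ (h + a * k') % q → k ≤ k'
  below {k} {k'} k<q k'≤k eq = m∸n≡0⇒m≤n (∣∧<⇒≡0 q∣k∸k' (≤-<-trans (m∸n≤m k k') k<q))
    where
    q∣k∸k' : q ∣ k ∸ k'
    q∣k∸k' = coprime-divisor q⊥a (subst (q ∣_)
      (trans ([m+n]∸[m+o]≡n∸o h (a * k) (a * k')) (sym (*-distribˡ-∸ a k k')))
      (%≡%⇒∣∸ q eq))

odd-coprimeTo-2 : ∀ t → Coprime (suc (t * 2)) 2
odd-coprimeTo-2 zero    = 1-coprimeTo 2
odd-coprimeTo-2 (suc t) = coprime-+ (odd-coprimeTo-2 t)

m*n+o<p*n : ∀ {m n o p} → m < p → o < n → m * n + o < p * n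
m*n+o<p*n {m} {n} {o} {p} m<p o<n =
  <-≤-trans (+-monoʳ-< (m * n) o<n) (subst (_≤ p * n) (+-comm n (m * n)) (*-monoˡ-≤ n m<p))

[m*n+o]%n≡o : ∀ m {n o} .{{_ : NonZero n}} → o < n → (m * n + o) % n ≡ o
[m*n+o]%n≡o m {n} {o} o<n =
  trans (cong (_% n) (+-comm (m * n) o)) (trans ([m+kn]%n≡m%n o m n) (m<n⇒m%n≡m o<n))

[m*n+o]%[p*n]≡[m%p]*n+o : ∀ m {n o} p .{{_ : NonZero p}} .{{_ : NonZero (p * n)}} → o < n →
                          (m * n + o) % (p * n) ≡ m % p * n + o
[m*n+o]%[p*n]≡[m%p]*n+o m {n} {o} p o<n =
  trans ([m*n+o]%[p*n]≡[m*n]%[p*n]+o m p o<n) (cong (_+ o) (sym (m%n*o≡m*o%[n*o] m p n)))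

toℕ-mod : ∀ {m n} .{{_ : NonZero n}} → m < n → toℕ (m mod n) ≡ m
toℕ-mod {m} {n} m<n = trans (Finₚ.toℕ-fromℕ< (m%n<n m n)) (m<n⇒m%n≡m m<n)

[n+a]∸b≡n∸[b∸a] : ∀ n {a b} → a ≤ b → n + a ∸ b ≡ n ∸ (b ∸ a)
[n+a]∸b≡n∸[b∸a] n {a} {b} a≤b = begin
  n + a ∸ b               ≡⟨ cong (n + a ∸_) (sym (m+[n∸m]≡n a≤b)) ⟩
  n + a ∸ (a + (b ∸ a))   ≡⟨ ∸-+-assoc (n + a) a (b ∸ a) ⟨
  n + a ∸ a ∸ (b ∸ a)     ≡⟨ cong (_∸ (b ∸ a)) (m+n∸n≡m n a) ⟩
  n ∸ (b ∸ a)             ∎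

q*b∸[a*b+c]≡[q∸1+a]*b+[b∸c] : ∀ {q a} b {c} → a < q → c ≤ b → q * b ∸ (a * b + c) ≡ (q ∸ suc a) * b + (b ∸ c)
q*b∸[a*b+c]≡[q∸1+a]*b+[b∸c] {q} {a} b {c} a<q c≤b = begin
  q * b ∸ (a * b + c)                                  ≡⟨ cong (_∸ (a * b + c)) q*b≡ ⟩
  a * b + c + ((q ∸ suc a) * b + (b ∸ c)) ∸ (a * b + c) ≡⟨ m+n∸m≡n (a * b + c) _ ⟩
  (q ∸ suc a) * b + (b ∸ c)                            ∎
  where
  regroup : ∀ a b c r e → a * b + c + (r * b + e) ≡ (a * b + r * b) + (c + e)
  regroup = solve-∀
  collect : ∀ a b r → (a * b + r * b) + b ≡ (suc a + r) * b
  collect = solve-∀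
  q*b≡ : q * b ≡ a * b + c + ((q ∸ suc a) * b + (b ∸ c))
  q*b≡ = sym (begin
    a * b + c + ((q ∸ suc a) * b + (b ∸ c))     ≡⟨ regroup a b c (q ∸ suc a) (b ∸ c) ⟩
    (a * b + (q ∸ suc a) * b) + (c + (b ∸ c))   ≡⟨ cong ((a * b + (q ∸ suc a) * b) +_) (m+[n∸m]≡n c≤b) ⟩
    (a * b + (q ∸ suc a) * b) + b               ≡⟨ collect a b (q ∸ suc a) ⟩
    (suc a + (q ∸ suc a)) * b                   ≡⟨ cong (_* b) (m+[n∸m]≡n a<q) ⟩
    q * b                                       ∎)

zdiff-≤ : ∀ {N} (x y : Fin N) → toℕ y ≤ toℕ x → zdiff N x y ≡ toℕ x ∸ toℕ y
zdiff-≤ x y y≤x with toℕ y ≤ᵇ toℕ x in eq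
... | true  = refl
... | false = ⊥-elim (subst T eq (≤⇒≤ᵇ y≤x))

zdiff-> : ∀ {N} (x y : Fin N) → toℕ x < toℕ y → zdiff N x y ≡ (N + toℕ x) ∸ toℕ y
zdiff-> x y x<y with toℕ y ≤ᵇ toℕ x in eq
... | true  = ⊥-elim (<⇒≱ x<y (≤ᵇ⇒≤ (toℕ y) (toℕ x) (subst T (sym eq) tt)))
... | false = refl

zdiff-unique : ∀ {N} .{{_ : NonZero N}} (x y : Fin N) {w} → w < N →
               toℕ x ≡ (toℕ y + w) % N → zdiff N x y ≡ w
zdiff-unique {N} x y {w} w<N x≡ with toℕ y + w <? N
... | yes y+w<N = begin
  zdiff N x y         ≡⟨ zdiff-≤ x y (subst (toℕ y ≤_) (sym x≡y+w) (m≤m+n (toℕ y) w)) ⟩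
  toℕ x ∸ toℕ y       ≡⟨ cong (_∸ toℕ y) x≡y+w ⟩
  toℕ y + w ∸ toℕ y   ≡⟨ m+n∸m≡n (toℕ y) w ⟩
  w                   ∎
  where
  x≡y+w : toℕ x ≡ toℕ y + w
  x≡y+w = trans x≡ (m<n⇒m%n≡m y+w<N)
... | no y+w≮N = begin
  zdiff N x y                  ≡⟨ zdiff-> x y x<y ⟩
  N + toℕ x ∸ toℕ y            ≡⟨ cong (λ r → N + r ∸ toℕ y) x≡y+w∸N ⟩
  N + (toℕ y + w ∸ N) ∸ toℕ y  ≡⟨ cong (_∸ toℕ y) (m+[n∸m]≡n N≤y+w) ⟩
  toℕ y + w ∸ toℕ y            ≡⟨ m+n∸m≡n (toℕ y) w ⟩
  w                            ∎
  where
  N≤y+w : N ≤ toℕ y + w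
  N≤y+w = ≮⇒≥ y+w≮N
  y+w<N+N : toℕ y + w < N + N
  y+w<N+N = +-mono-< (Finₚ.toℕ<n y) w<N
  x≡y+w∸N : toℕ x ≡ toℕ y + w ∸ N
  x≡y+w∸N = trans x≡ (trans (sym (m≤n⇒[n∸m]%m≡n%m N≤y+w)) (m<n⇒m%n≡m (m<n+o⇒m∸n<o _ N y+w<N+N)))
  x<y : toℕ x < toℕ y
  x<y = subst (_< toℕ y) (sym x≡y+w∸N)
          (+-cancelˡ-< N _ (toℕ y) (subst (_< N + toℕ y) (sym (m+[n∸m]≡n N≤y+w))
            (subst (toℕ y + w <_) (+-comm (toℕ y) N) (+-monoʳ-< (toℕ y) w<N))))

zdiff-swap : ∀ {N} (x y : Fin N) → 0 < zdiff N x y → zdiff N y x ≡ N ∸ zdiff N x y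
zdiff-swap {N} x y 0<xy with <-cmp (toℕ x) (toℕ y)
... | tri< x<y _ _ = begin
  zdiff N y x                   ≡⟨ zdiff-≤ y x (<⇒≤ x<y) ⟩
  toℕ y ∸ toℕ x                 ≡⟨ m∸[m∸n]≡n (≤-trans (m∸n≤m (toℕ y) (toℕ x)) (<⇒≤ (Finₚ.toℕ<n y))) ⟨
  N ∸ (N ∸ (toℕ y ∸ toℕ x))     ≡⟨ cong (N ∸_) ([n+a]∸b≡n∸[b∸a] N (<⇒≤ x<y)) ⟨
  N ∸ (N + toℕ x ∸ toℕ y)       ≡⟨ cong (N ∸_) (zdiff-> x y x<y) ⟨
  N ∸ zdiff N x y               ∎
... | tri≈ _ x≡y _ = ⊥-elim (<-irrefl (sym xy≡0) 0<xy)
  where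
  xy≡0 : zdiff N x y ≡ 0
  xy≡0 = trans (zdiff-≤ x y (≤-reflexive (sym x≡y))) (trans (cong (_∸ toℕ y) x≡y) (n∸n≡0 (toℕ y)))
... | tri> _ _ y<x = begin
  zdiff N y x                   ≡⟨ zdiff-> y x y<x ⟩
  N + toℕ y ∸ toℕ x             ≡⟨ [n+a]∸b≡n∸[b∸a] N (<⇒≤ y<x) ⟩
  N ∸ (toℕ x ∸ toℕ y)           ≡⟨ cong (N ∸_) (zdiff-≤ x y (<⇒≤ y<x)) ⟨
  N ∸ zdiff N x y               ∎

record EnumeratesClass (q b c : ℕ) (w : ℕ → ℕ) : Set where
  field
    c<b             : c < b
    index           : ℕ → ℕ
    index<q         : ∀ {k} → k < q → index k < q
    index-injective : ∀ {k k'} → k < q → k' < q → index k ≡ index k' → k ≡ k'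
    w≡index*b+c     : ∀ {k} → k < q → w k ≡ index k * b + c

mult-enumeratesClass : ∀ {q b c w d} .{{_ : NonZero b}} → EnumeratesClass q b c w →
                       d < q * b → mult d (applyDownFrom w q) ≡ mult (d % b) (c ∷ [])
mult-enumeratesClass {q} {b} {c} {w} {d} E d<qb with c ≟ d % b
... | no c≢d%b =
  trans (mult-applyDownFrom-absent w q (λ k<q wk≡d → c≢d%b (trans (sym (w%b≡c k<q)) (cong (_% b) wk≡d))))
        (sym (cong length (filter-reject (_≟ d % b) c≢d%b)))
  where
  open EnumeratesClass E
  w%b≡c : ∀ {k} → k < q → w k % b ≡ c
  w%b≡c {k} k<q = trans (cong (_% b) (w≡index*b+c k<q)) ([m*n+o]%n≡o (index k) c<b)
... | yes c≡d%b =
  trans (mult-applyDownFrom-unique w q k₀<q wk₀≡d unique)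
        (sym (cong length (filter-accept (_≟ d % b) c≡d%b)))
  where
  open EnumeratesClass E
  preimage = injectiveOn⇒surjectiveOn index index<q index-injective (m<n*o⇒m/o<n d<qb)
  k₀ = proj₁ preimage
  k₀<q = proj₁ (proj₂ preimage)
  wk₀≡d : w k₀ ≡ d
  wk₀≡d = begin
    w k₀               ≡⟨ w≡index*b+c k₀<q ⟩
    index k₀ * b + c   ≡⟨ cong (λ e → e * b + c) (proj₂ (proj₂ preimage)) ⟩
    d / b * b + c      ≡⟨ cong (d / b * b +_) c≡d%b ⟩
    d / b * b + d % b  ≡⟨ +-comm (d / b * b) (d % b) ⟩
    d % b + d / b * b  ≡⟨ m≡m%n+[m/n]*n d b ⟨
    d                  ∎
  unique : ∀ {k} → k < q → w k ≡ d → k ≡ k₀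
  unique {k} k<q wk≡d = index-injective k<q k₀<q (*-cancelʳ-≡ _ _ b (+-cancelʳ-≡ c _ _
    (trans (sym (w≡index*b+c k<q)) (trans wk≡d (trans (sym wk₀≡d) (w≡index*b+c k₀<q))))))

enumeratesClass-swap : ∀ {q b c} {x y : ℕ → Fin (q * b)} → 0 < c →
                       EnumeratesClass q b c (λ k → zdiff (q * b) (x k) (y k)) →
                       EnumeratesClass q b (b ∸ c) (λ k → zdiff (q * b) (y k) (x k))
enumeratesClass-swap {q} {b} {c} {x} {y} 0<c E = record
  { c<b             = ∸-monoʳ-< 0<c (<⇒≤ c<b)
  ; index           = λ k → q ∸ suc (index k)
  ; index<q         = λ k<q → ∸-monoʳ-< z<s (index<q k<q)
  ; index-injective = λ k<q k'<q eq →
      index-injective k<q k'<q (suc-injective (∸-cancelˡ-≡ (index<q k<q) (index<q k'<q) eq))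
  ; w≡index*b+c     = λ {k} k<q → begin
      zdiff (q * b) (y k) (x k)           ≡⟨ zdiff-swap (x k) (y k) (positive k<q) ⟩
      q * b ∸ zdiff (q * b) (x k) (y k)   ≡⟨ cong (q * b ∸_) (w≡index*b+c k<q) ⟩
      q * b ∸ (index k * b + c)           ≡⟨ q*b∸[a*b+c]≡[q∸1+a]*b+[b∸c] b (index<q k<q) (<⇒≤ c<b) ⟩
      (q ∸ suc (index k)) * b + (b ∸ c)   ∎
  }
  where
  open EnumeratesClass E
  positive : ∀ {k} → k < q → 0 < zdiff (q * b) (x k) (y k)
  positive k<q = subst (0 <_) (sym (w≡index*b+c k<q)) (<-≤-trans 0<c (m≤n+m c _))

module _ {n v : ℕ} (i j : Fin n) where

  Δ-applyDownFrom : ∀ (g : ℕ → Block n v) {A : Set} (w : A → ℕ → ℕ) (ma : Maybe A) →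
                    (∀ k → diffsIn i j (g k) ≡ maybe (λ a → w a k ∷ []) [] ma) →
                    ∀ l → Δ i j (applyDownFrom g l) ≡ maybe (λ a → applyDownFrom (w a) l) [] ma
  Δ-applyDownFrom g w nothing  _     zero    = refl
  Δ-applyDownFrom g w (just a) _     zero    = refl
  Δ-applyDownFrom g w nothing  shape (suc l) = cong₂ _++_ (shape l) (Δ-applyDownFrom g w nothing shape l)
  Δ-applyDownFrom g w (just a) shape (suc l) = cong₂ _++_ (shape l) (Δ-applyDownFrom g w (just a) shape l)

  Δ-concatMap-≡[] : ∀ {A : Set} (f : A → List (Block n v)) xs →
                    (∀ {x} → x ∈ xs → Δ i j (f x) ≡ []) → Δ i j (concatMap f xs) ≡ []
  Δ-concatMap-≡[] f []       _     = refl
  Δ-concatMap-≡[] f (x ∷ xs) empty = begin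
    Δ i j (f x ++ concatMap f xs)
      ≡⟨ concatMap-++ (diffsIn i j) (f x) (concatMap f xs) ⟩
    Δ i j (f x) ++ Δ i j (concatMap f xs)
      ≡⟨ cong₂ _++_ (empty (here refl)) (Δ-concatMap-≡[] f xs (empty ∘ there)) ⟩
    []
      ∎

  mult-Δ-concatMap : ∀ {A : Set} (f : A → List (Block n v)) (g : A → List ℕ) d r xs →
                     (∀ {x} → x ∈ xs → mult d (Δ i j (f x)) ≡ mult r (g x)) →
                     mult d (Δ i j (concatMap f xs)) ≡ mult r (concatMap g xs)
  mult-Δ-concatMap f g d r []       _      = refl
  mult-Δ-concatMap f g d r (x ∷ xs) counts = begin
    mult d (Δ i j (f x ++ concatMap f xs))
      ≡⟨ cong (mult d) (concatMap-++ (diffsIn i j) (f x) (concatMap f xs)) ⟩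
    mult d (Δ i j (f x) ++ Δ i j (concatMap f xs))
      ≡⟨ mult-++ d (Δ i j (f x)) _ ⟩
    mult d (Δ i j (f x)) + mult d (Δ i j (concatMap f xs))
      ≡⟨ cong₂ _+_ (counts (here refl)) (mult-Δ-concatMap f g d r xs (counts ∘ there)) ⟩
    mult r (g x) + mult r (concatMap g xs)
      ≡⟨ mult-++ r (g x) _ ⟨
    mult r (g x ++ concatMap g xs)
      ∎

∤-indicator : (t : ℕ) .{{_ : NonZero t}} → ℕ → ℕ
∤-indicator t d = if d % t ≡ᵇ 0 then 0 else 1

CoversNonMultiples : (n N t : ℕ) .{{_ : NonZero t}} → List (Block n N) → Set
CoversNonMultiples n N t Bs =
  (∀ i → Δ i i Bs ≡ []) ×
  (∀ i j → i ≢ j → ∀ d → d < N → mult d (Δ i j Bs) ≡ ∤-indicator t d)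

∤-indicator-InS : ∀ {m t d} .{{_ : NonZero t}} → InS m t d → ∤-indicator t d ≡ 0
∤-indicator-InS {t = t} (k , _ , refl) = cong (λ r → if r ≡ᵇ 0 then 0 else 1) (m*n%n≡0 k t)

∤-indicator-¬InS : ∀ {m t d} .{{_ : NonZero t}} → d < m * t → ¬ InS m t d → ∤-indicator t d ≡ 1
∤-indicator-¬InS {t = t} {d} d<mt d∉S with d % t ≡ᵇ 0 in eq
... | false = refl
... | true  = contradiction (d / t , m<n*o⇒m/o<n d<mt , d≡d/t*t) d∉S
  where
  d≡d/t*t : d ≡ d / t * t
  d≡d/t*t = trans (m≡m%n+[m/n]*n d t) (cong (_+ d / t * t) (≡ᵇ⇒≡ (d % t) 0 (subst T (sym eq) tt)))

coversNonMultiples⇒Exists3SCHGDD : ∀ {n m t} .{{_ : NonZero t}} →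
                                   Σ (List (Block n (m * t))) (CoversNonMultiples n (m * t) t) →
                                   Exists3SCHGDD n m t
coversNonMultiples⇒Exists3SCHGDD (Bs , diagonal , counts) =
  Bs , diagonal , λ i j i≢j d d<mt →
    (λ d∈S → trans (counts i j i≢j d d<mt) (∤-indicator-InS d∈S)) ,
    (λ d∉S → trans (counts i j i≢j d d<mt) (∤-indicator-¬InS d<mt d∉S))

record BaseBlock : Set where
  constructor baseBlock
  field
    row₀ row₁ row₂ : Fin 6
    c₁ c₃          : ℕ
    {row₀≢row₁}    : False (row₀ Fin.≟ row₁)
    {row₀≢row₂}    : False (row₀ Fin.≟ row₂)
    {row₁≢row₂}    : False (row₁ Fin.≟ row₂)
    {0<c₁}         : True (0 <? c₁)
    {c₁<9}         : True (c₁ <? 9)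
    {0<c₃}         : True (0 <? c₃)
    {c₃<9}         : True (c₃ <? 9)
    {0<c₂}         : True (0 <? (c₁ + c₃) % 9)

  c₂ : ℕ
  c₂ = (c₁ + c₃) % 9

open BaseBlock

row : BaseBlock → Fin 3 → Fin 6
row F 0F = row₀ F
row F 1F = row₁ F
row F 2F = row₂ F

posOf : BaseBlock → Fin 6 → Maybe (Fin 3)
posOf F i =
  if does (row₀ F Fin.≟ i) then just 0F else
  if does (row₁ F Fin.≟ i) then just 1F else
  if does (row₂ F Fin.≟ i) then just 2F else nothing

Arc : Set
Arc = Σ (Fin 3 × Fin 3) λ (s , s') → s ≢ s'

arcBetween : Fin 3 → Fin 3 → Maybe Arc
arcBetween s s' with s Fin.≟ s'
... | yes _    = nothing
... | no s≢s' = just ((s , s') , s≢s')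

arcOf : BaseBlock → Fin 6 → Fin 6 → Maybe Arc
arcOf F i j = posOf F i >>= λ s → posOf F j >>= arcBetween s

arcBetween-refl : ∀ s → arcBetween s s ≡ nothing
arcBetween-refl s with s Fin.≟ s
... | yes _   = refl
... | no s≢s = contradiction refl s≢s

>>=-diagonal : ∀ {A B : Set} (ma : Maybe A) (f : A → A → Maybe B) → (∀ a → f a a ≡ nothing) →
               (ma >>= λ a → ma >>= f a) ≡ nothing
>>=-diagonal nothing  f _      = refl
>>=-diagonal (just a) f f-diag = f-diag a

arcOf-diagonal : ∀ F i → arcOf F i i ≡ nothing
arcOf-diagonal F i = >>=-diagonal (posOf F i) arcBetween arcBetween-refl

arcResidue : BaseBlock → Arc → ℕ
arcResidue F ((1F , 0F) , _) = c₁ F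
arcResidue F ((0F , 1F) , _) = 9 ∸ c₁ F
arcResidue F ((2F , 0F) , _) = c₂ F
arcResidue F ((0F , 2F) , _) = 9 ∸ c₂ F
arcResidue F ((2F , 1F) , _) = c₃ F
arcResidue F ((1F , 2F) , _) = 9 ∸ c₃ F
arcResidue F ((0F , 0F) , s≢s) = contradiction refl s≢s
arcResidue F ((1F , 1F) , s≢s) = contradiction refl s≢s
arcResidue F ((2F , 2F) , s≢s) = contradiction refl s≢s

arcResidues : BaseBlock → Fin 6 → Fin 6 → List ℕ
arcResidues F i j = maybe (λ a → arcResidue F a ∷ []) [] (arcOf F i j)

baseBlocks : List BaseBlock
baseBlocks =
  baseBlock (# 0) (# 5) (# 1) 7 1 ∷ baseBlock (# 0) (# 2) (# 1) 4 1 ∷ baseBlock (# 0) (# 3) (# 1) 4 7 ∷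
  baseBlock (# 0) (# 2) (# 4) 7 7 ∷ baseBlock (# 0) (# 2) (# 4) 1 1 ∷ baseBlock (# 0) (# 3) (# 2) 7 7 ∷
  baseBlock (# 0) (# 3) (# 4) 1 7 ∷ baseBlock (# 0) (# 5) (# 2) 4 7 ∷ baseBlock (# 0) (# 5) (# 3) 1 7 ∷
  baseBlock (# 2) (# 4) (# 3) 4 4 ∷ baseBlock (# 2) (# 5) (# 3) 1 4 ∷ baseBlock (# 1) (# 2) (# 5) 4 7 ∷
  baseBlock (# 1) (# 2) (# 3) 7 1 ∷ baseBlock (# 0) (# 1) (# 2) 7 1 ∷ baseBlock (# 1) (# 4) (# 3) 4 1 ∷
  baseBlock (# 3) (# 4) (# 5) 1 7 ∷ baseBlock (# 0) (# 4) (# 5) 1 1 ∷ baseBlock (# 0) (# 4) (# 3) 7 7 ∷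
  baseBlock (# 0) (# 4) (# 5) 4 4 ∷ baseBlock (# 0) (# 1) (# 5) 4 1 ∷ baseBlock (# 0) (# 1) (# 3) 1 1 ∷
  baseBlock (# 2) (# 3) (# 5) 4 4 ∷ baseBlock (# 1) (# 3) (# 5) 4 1 ∷ baseBlock (# 1) (# 3) (# 4) 7 4 ∷
  baseBlock (# 2) (# 3) (# 5) 7 7 ∷ baseBlock (# 1) (# 4) (# 2) 7 7 ∷ baseBlock (# 1) (# 4) (# 2) 1 1 ∷
  baseBlock (# 2) (# 5) (# 4) 4 1 ∷ baseBlock (# 1) (# 5) (# 4) 4 4 ∷ baseBlock (# 1) (# 5) (# 4) 7 7 ∷
  []

residues : Fin 6 → Fin 6 → List ℕ
residues i j = concatMap (λ F → arcResidues F i j) baseBlocks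

residues-cover : ∀ i j → i ≢ j → ∀ {r} → r < 9 → mult r (residues i j) ≡ ∤-indicator 3 r
residues-cover i j i≢j {r} r<9 =
  [ (λ i≡j → contradiction i≡j i≢j)
  , subst (λ r → mult r (residues i j) ≡ ∤-indicator 3 r) (Finₚ.toℕ-fromℕ< r<9)
  ]′ (table i j (fromℕ< r<9))
  where
  table : ∀ i j (r : Fin 9) → i ≡ j ⊎ mult (toℕ r) (residues i j) ≡ ∤-indicator 3 (toℕ r)
  table = from-yes (Finₚ.all? {n = 6} λ i → Finₚ.all? {n = 6} λ j → Finₚ.all? {n = 9} λ r →
                    (i Fin.≟ j) ⊎-dec (mult (toℕ r) (residues i j) ≟ ∤-indicator 3 (toℕ r)))

blockOf : ∀ {v} → BaseBlock → (Fin 3 → Fin v) → Block 6 v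
blockOf F x = block (row F 0F , x 0F) (row F 1F , x 1F) (row F 2F , x 2F)
  (toWitnessFalse (row₀≢row₁ F) ∘ cong proj₁)
  (toWitnessFalse (row₀≢row₂ F) ∘ cong proj₁)
  (toWitnessFalse (row₁≢row₂ F) ∘ cong proj₁)

arcDiff : ∀ {v} → (Fin 3 → Fin v) → Arc → ℕ
arcDiff {v} x ((s , s') , _) = zdiff v (x s) (x s')

rowPairs×baseBlocks : List ((Fin 6 × Fin 6) × BaseBlock)
rowPairs×baseBlocks = cartesianProduct (cartesianProduct (allFin 6) (allFin 6)) baseBlocks

-- Evaluated for all rows and base blocks at once; the coordinates x stay abstract, so only the row
-- comparisons inside diffsIn are computed.
diffsIn-blockOf-evaluated : ∀ {v} (x : Fin 3 → Fin v) →
                            map (λ ((i , j) , F) → diffsIn i j (blockOf F x)) rowPairs×baseBlocks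
                          ≡ map (λ ((i , j) , F) → maybe (λ a → arcDiff x a ∷ []) [] (arcOf F i j)) rowPairs×baseBlocks
diffsIn-blockOf-evaluated x = refl

diffsIn-blockOf : ∀ {v} i j {F} → F ∈ baseBlocks → (x : Fin 3 → Fin v) →
                  diffsIn i j (blockOf F x) ≡ maybe (λ a → arcDiff x a ∷ []) [] (arcOf F i j)
diffsIn-blockOf i j F∈ x =
  map-≡⇒∈⇒≡ (λ ((i , j) , F) → diffsIn i j (blockOf F x))
            (λ ((i , j) , F) → maybe (λ a → arcDiff x a ∷ []) [] (arcOf F i j))
            {rowPairs×baseBlocks} (diffsIn-blockOf-evaluated x)
            (∈-cartesianProduct⁺ (∈-cartesianProduct⁺ (∈-allFin i) (∈-allFin j)) F∈)

module Development (t : ℕ) where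

  q : ℕ
  q = suc (t * 2)

  N : ℕ
  N = q * 9

  value : BaseBlock → Fin 3 → ℕ → Fin N
  value F 0F k = Fin.zero
  value F 1F k = (k * 9 + c₁ F) mod N
  value F 2F k = (k * 9 + c₁ F + (k * 9 + c₃ F)) mod N

  develop : BaseBlock → ℕ → Block 6 N
  develop F k = blockOf F (λ s → value F s k)

  blocksOf : BaseBlock → List (Block 6 N)
  blocksOf F = applyDownFrom (develop F) q

  blocks : List (Block 6 N)
  blocks = concatMap blocksOf baseBlocks

  arcSequence : BaseBlock → Arc → ℕ → ℕ
  arcSequence F a k = arcDiff (λ s → value F s k) a

  enumerates₁₀ : ∀ F → EnumeratesClass q 9 (c₁ F) (λ k → zdiff N (value F 1F k) (value F 0F k))
  enumerates₁₀ F = record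
    { c<b             = toWitness (c₁<9 F)
    ; index           = λ k → k
    ; index<q         = λ k<q → k<q
    ; index-injective = λ _ _ eq → eq
    ; w≡index*b+c     = λ k<q → toℕ-mod (m*n+o<p*n k<q (toWitness (c₁<9 F)))
    }

  enumerates₂₁ : ∀ F → EnumeratesClass q 9 (c₃ F) (λ k → zdiff N (value F 2F k) (value F 1F k))
  enumerates₂₁ F = record
    { c<b             = toWitness (c₃<9 F)
    ; index           = λ k → k
    ; index<q         = λ k<q → k<q
    ; index-injective = λ _ _ eq → eq
    ; w≡index*b+c     = λ {k} k<q → zdiff-unique (value F 2F k) (value F 1F k)
        (m*n+o<p*n k<q (toWitness (c₃<9 F)))
        (trans (Finₚ.toℕ-fromℕ< _)
               (cong (λ y → (y + (k * 9 + c₃ F)) % N) (sym (toℕ-mod (m*n+o<p*n k<q (toWitness (c₁<9 F)))))))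
    }

  enumerates₂₀ : ∀ F → EnumeratesClass q 9 (c₂ F) (λ k → zdiff N (value F 2F k) (value F 0F k))
  enumerates₂₀ F = record
    { c<b             = m%n<n (c₁ F + c₃ F) 9
    ; index           = λ k → (h + 2 * k) % q
    ; index<q         = λ {k} _ → m%n<n (h + 2 * k) q
    ; index-injective = affine%-injective {h = h} (odd-coprimeTo-2 t)
    ; w≡index*b+c     = λ {k} _ → begin
        toℕ (value F 2F k)                         ≡⟨ Finₚ.toℕ-fromℕ< _ ⟩
        (k * 9 + c₁ F + (k * 9 + c₃ F)) % N         ≡⟨ cong (_% N) (regroup k) ⟩
        ((h + 2 * k) * 9 + c₂ F) % (q * 9)          ≡⟨ [m*n+o]%[p*n]≡[m%p]*n+o (h + 2 * k) q (m%n<n (c₁ F + c₃ F) 9) ⟩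
        (h + 2 * k) % q * 9 + c₂ F                  ∎
    }
    where
    h : ℕ
    h = (c₁ F + c₃ F) / 9
    regroup : ∀ k → k * 9 + c₁ F + (k * 9 + c₃ F) ≡ (h + 2 * k) * 9 + c₂ F
    regroup k = begin
      k * 9 + c₁ F + (k * 9 + c₃ F)   ≡⟨ collect k (c₁ F) (c₃ F) ⟩
      2 * k * 9 + (c₁ F + c₃ F)       ≡⟨ cong (2 * k * 9 +_) (m≡m%n+[m/n]*n (c₁ F + c₃ F) 9) ⟩
      2 * k * 9 + (c₂ F + h * 9)      ≡⟨ distribute k (c₂ F) h ⟩
      (h + 2 * k) * 9 + c₂ F          ∎
      where
      collect : ∀ k x y → k * 9 + x + (k * 9 + y) ≡ 2 * k * 9 + (x + y)
      collect = solve-∀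
      distribute : ∀ k r h → 2 * k * 9 + (r + h * 9) ≡ (h + 2 * k) * 9 + r
      distribute = solve-∀

  arcSequence-enumerates : ∀ F a → EnumeratesClass q 9 (arcResidue F a) (arcSequence F a)
  arcSequence-enumerates F ((1F , 0F) , _) = enumerates₁₀ F
  arcSequence-enumerates F ((0F , 1F) , _) =
    enumeratesClass-swap {x = value F 1F} {value F 0F} (toWitness (0<c₁ F)) (enumerates₁₀ F)
  arcSequence-enumerates F ((2F , 0F) , _) = enumerates₂₀ F
  arcSequence-enumerates F ((0F , 2F) , _) =
    enumeratesClass-swap {x = value F 2F} {value F 0F} (toWitness (0<c₂ F)) (enumerates₂₀ F)
  arcSequence-enumerates F ((2F , 1F) , _) = enumerates₂₁ F
  arcSequence-enumerates F ((1F , 2F) , _) =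
    enumeratesClass-swap {x = value F 2F} {value F 1F} (toWitness (0<c₃ F)) (enumerates₂₁ F)
  arcSequence-enumerates F ((0F , 0F) , s≢s) = contradiction refl s≢s
  arcSequence-enumerates F ((1F , 1F) , s≢s) = contradiction refl s≢s
  arcSequence-enumerates F ((2F , 2F) , s≢s) = contradiction refl s≢s

  Δ-blocksOf : ∀ i j {F} → F ∈ baseBlocks →
               Δ i j (blocksOf F) ≡ maybe (λ a → applyDownFrom (arcSequence F a) q) [] (arcOf F i j)
  Δ-blocksOf i j {F} F∈ =
    Δ-applyDownFrom i j (develop F) (arcSequence F) (arcOf F i j) (λ k → diffsIn-blockOf i j F∈ (λ s → value F s k)) q

  mult-Δ-blocksOf : ∀ i j {F} → F ∈ baseBlocks → ∀ {d} → d < N →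
                    mult d (Δ i j (blocksOf F)) ≡ mult (d % 9) (arcResidues F i j)
  mult-Δ-blocksOf i j {F} F∈ {d} d<N = trans (cong (mult d) (Δ-blocksOf i j F∈)) (count (arcOf F i j))
    where
    count : ∀ ma → mult d (maybe (λ a → applyDownFrom (arcSequence F a) q) [] ma)
                 ≡ mult (d % 9) (maybe (λ a → arcResidue F a ∷ []) [] ma)
    count nothing  = refl
    count (just a) = mult-enumeratesClass (arcSequence-enumerates F a) d<N

  blocks-cover : CoversNonMultiples 6 N 3 blocks
  blocks-cover = diagonal , counts
    where
    diagonal : ∀ i → Δ i i blocks ≡ []
    diagonal i = Δ-concatMap-≡[] i i blocksOf baseBlocks λ {F} F∈ →
      trans (Δ-blocksOf i i F∈) (cong (maybe (λ a → applyDownFrom (arcSequence F a) q) []) (arcOf-diagonal F i))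
    counts : ∀ i j → i ≢ j → ∀ d → d < N → mult d (Δ i j blocks) ≡ ∤-indicator 3 d
    counts i j i≢j d d<N = begin
      mult d (Δ i j blocks)         ≡⟨ mult-Δ-concatMap i j blocksOf (λ F → arcResidues F i j) d (d % 9) baseBlocks
                                         (λ F∈ → mult-Δ-blocksOf i j F∈ d<N) ⟩
      mult (d % 9) (residues i j)   ≡⟨ residues-cover i j i≢j (m%n<n d 9) ⟩
      ∤-indicator 3 (d % 9)         ≡⟨ cong (λ r → if r ≡ᵇ 0 then 0 else 1) (m∣n⇒o%n%m≡o%m 3 9 d (divides 3 refl)) ⟩
      ∤-indicator 3 d               ∎

-- The hypothesis 0 < m is implied by m % 6 ≡ 3.
lemma6p5 : (m : ℕ) → 0 < m → m % 6 ≡ 3 → Exists3SCHGDD 6 m 3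
lemma6p5 m _ m%6≡3 = coversNonMultiples⇒Exists3SCHGDD {m = m}
  (subst (λ N → Σ (List (Block 6 N)) (CoversNonMultiples 6 N 3)) (sym m*3≡q*9) (blocks , blocks-cover))
  where
  open Development (m / 6) using (q; blocks; blocks-cover)
  m*3≡q*9 : m * 3 ≡ q * 9
  m*3≡q*9 = trans (cong (_* 3) (trans (m≡m%n+[m/n]*n m 6) (cong (_+ m / 6 * 6) m%6≡3))) (triple (m / 6))
    where
    triple : ∀ t → (3 + t * 6) * 3 ≡ suc (t * 2) * 9
    triple = solve-∀
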